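{- Let $p\ge 3$ and $q\ge 3$ be integers, $t=(p-1)q$, and let $G$ be a simple undirected graph in which every vertex has degree at most $t+1$. Let $H_1$ and $H_2$ be two different $K^p_q$'s of $G$ with a common vertex. Then $H_1\cap H_2$ contains a subgraph isomorphic to $I_{q-1}\times K^{p-1}_q$.
   Context: $K^p_q$ is the complete $p$-partite graph with $p$ color classes of $q$ vertices each; a "$K^p_q$ of $G$" is a subgraph of $G$ (not necessarily induced) isomorphic to it. $I_n$ is the edgeless graph on $n$ vertices. For vertex-disjoint graphs $G_1=(V_1,E_1)$, $G_2=(V_2,E_2)$, the product $G_1\times G_2$ is $(V_1\cup V_2, E_1\cup E_2\cup\{(a,b):a\in V_1,b\in V_2\})$. For graphs $H_1,H_2$, $H_1\cap H_2=(V(H_1)\cap V(H_2),E(H_1)\cap E(H_2))$. -}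

module Defs where

open import Data.Nat using (ℕ; _∸_)
open import Data.Bool using (Bool; T)
open import Data.Fin using (Fin)
open import Data.Vec using (countᵇ; allFin)
open import Data.Product using (_×_; Σ; ∃; proj₁; proj₂; _,_)
open import Data.Sum using (_⊎_; inj₁; inj₂)
open import Data.Unit using (⊤)
open import Data.Empty using (⊥)
open import Relation.Nullary using (¬_)
open import Relation.Binary.PropositionalEquality using (_≡_; _≢_)
open import Function.Bundles using (_⇔_)
open import Function.Definitions using (Injective)
open import Level using (0ℓ; Level) renaming (suc to lsuc)

record FinGraph (n : ℕ) : Set where
  field
    adj    : Fin n → Fin n → Bool
    sym    : ∀ u v → adj u v ≡ adj v u
    irrefl : ∀ v → adj v v ≡ Data.Bool.false

open FinGraph public

Adj : ∀ {n} → FinGraph n → Fin n → Fin n → Set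
Adj G u v = T (adj G u v)

degree : ∀ {n} → FinGraph n → Fin n → ℕ
degree {n} G v = countᵇ (adj G v) (allFin n)

record AbsGraph : Set₁ where
  field
    Vtx : Set
    E   : Vtx → Vtx → Set

open AbsGraph public

Kpq : ℕ → ℕ → AbsGraph
Kpq p q = record { Vtx = Fin p × Fin q ; E = λ x y → proj₁ x ≢ proj₁ y }

Iₙ : ℕ → AbsGraph
Iₙ n = record { Vtx = Fin n ; E = λ _ _ → ⊥ }

-- product (join) G₁ × G₂ of vertex-disjoint graphs
_×ᴳ_ : AbsGraph → AbsGraph → AbsGraph
G₁ ×ᴳ G₂ = record { Vtx = Vtx G₁ ⊎ Vtx G₂ ; E = J }
  where
  J : Vtx G₁ ⊎ Vtx G₂ → Vtx G₁ ⊎ Vtx G₂ → Set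
  J (inj₁ a) (inj₁ b) = E G₁ a b
  J (inj₂ a) (inj₂ b) = E G₂ a b
  J (inj₁ _) (inj₂ _) = ⊤
  J (inj₂ _) (inj₁ _) = ⊤

-- A (not necessarily induced) subgraph of G: a vertex set and an edge set,
-- edges are edges of G, symmetric, and with both ends in the vertex set.
record Subgraph {n : ℕ} (G : FinGraph n) : Set₁ where
  field
    inV   : Fin n → Set
    inE   : Fin n → Fin n → Set
    E⊆G   : ∀ {u v} → inE u v → Adj G u v
    E-sym : ∀ {u v} → inE u v → inE v u
    E-end : ∀ {u v} → inE u v → inV u × inV v

open Subgraph public

SameSubgraph : ∀ {n} {G : FinGraph n} → Subgraph G → Subgraph G → Set
SameSubgraph H₁ H₂ =
  (∀ v → inV H₁ v ⇔ inV H₂ v) × (∀ u v → inE H₁ u v ⇔ inE H₂ u v)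

_∩ˢ_ : ∀ {n} {G : FinGraph n} → Subgraph G → Subgraph G → Subgraph G
H₁ ∩ˢ H₂ = record
  { inV   = λ v → inV H₁ v × inV H₂ v
  ; inE   = λ u v → inE H₁ u v × inE H₂ u v
  ; E⊆G   = λ e → E⊆G H₁ (proj₁ e)
  ; E-sym = λ e → E-sym H₁ (proj₁ e) , E-sym H₂ (proj₂ e)
  ; E-end = λ e → (proj₁ (E-end H₁ (proj₁ e)) , proj₁ (E-end H₂ (proj₂ e)))
                , (proj₂ (E-end H₁ (proj₁ e)) , proj₂ (E-end H₂ (proj₂ e)))
  }

IsomorphicTo : ∀ {n} {G : FinGraph n} → Subgraph G → AbsGraph → Set
IsomorphicTo {n} H K =
  Σ (Vtx K → Fin n) λ f →
    Injective _≡_ _≡_ f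
    × (∀ v → inV H v ⇔ ∃ λ x → f x ≡ v)
    × (∀ x y → E K x y ⇔ inE H (f x) (f y))

ContainsCopyOf : ∀ {n} {G : FinGraph n} → Subgraph G → AbsGraph → Set
ContainsCopyOf {n} H K =
  Σ (Vtx K → Fin n) λ g →
    Injective _≡_ _≡_ g
    × (∀ x → inV H (g x))
    × (∀ x y → E K x y → inE H (g x) (g y))

-- At a vertex w shared by two copies of K^p_q, w has t = (p - 1) q neighbours inside either copy
-- and degree at most t + 1, so at most one neighbour of w in one copy fails to be its neighbour in
-- the other.  Applied at suitable common vertices this shows that at most one vertex a of H₁ lies
-- outside H₂, and that two vertices of H₁ ∩ H₂ in different classes of H₁ also lie in different
-- classes of H₂.  Hence H₁ ∩ H₂ contains H₁ minus a, and there the rest of the class of a is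
-- joined to the other p - 1 classes, a copy of I_{q-1} × K^{p-1}_q.
module Submission where

open import Defs hiding (sym)
open import Data.Nat using (ℕ; zero; suc; s≤s; _≤_; _∸_; _*_; _+_)
open import Data.Nat.Properties using (≤-refl; ≤-trans; n≤1+n; 1+n≰n; +-comm)
open import Data.Bool using (Bool; true; false; T)
open import Data.Fin using (Fin; zero; suc; punchIn; punchOut; _≟_; remQuot; combine)
open import Data.Fin.Properties
  using (any?; injective⇒≤; 0≢1+n; punchIn-injective; punchInᵢ≢i; punchOut-injective; punchIn-punchOut; combine-remQuot)
open import Data.Vec using (Vec; _∷_; tabulate; countᵇ)
open import Data.Vec.Functional using () renaming (_∷_ to _◂_)
open import Data.Product using (_×_; ∃; Σ; _,_; proj₁; proj₂; uncurry)
open import Data.Sum using (inj₁; inj₂)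
open import Data.Empty using (⊥; ⊥-elim)
open import Function using (_∘_; id)
open import Function.Bundles using (Equivalence; _⇔_)
open import Function.Definitions using (Injective)
open import Relation.Nullary using (¬_; Dec; yes; no)
open import Relation.Nullary.Decidable using (map′; decidable-stable; ¬?)
open import Relation.Binary.PropositionalEquality using (_≡_; _≢_; refl; sym; trans; cong; cong₂; subst)

any?-× : ∀ {m k} {P : Fin m × Fin k → Set} → (∀ x → Dec (P x)) → Dec (∃ P)
any?-× P? = map′ (λ (i , j , pij) → (i , j) , pij) (λ ((i , j) , pij) → i , j , pij)
                 (any? λ i → any? λ j → P? (i , j))

remQuot-injective : ∀ {m} k {i j : Fin (m * k)} → remQuot {m} k i ≡ remQuot k j → i ≡ j
remQuot-injective {m} k {i} {j} eq =
  trans (sym (combine-remQuot {m} k i)) (trans (cong (uncurry combine) eq) (combine-remQuot {m} k j))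

injective-◂ : ∀ {A : Set} {m} {a : A} {f : Fin m → A} →
              (∀ i → f i ≢ a) → Injective _≡_ _≡_ f → Injective _≡_ _≡_ (a ◂ f)
injective-◂ a∉f inj {zero}  {zero}  _  = refl
injective-◂ a∉f inj {zero}  {suc j} eq = ⊥-elim (a∉f j (sym eq))
injective-◂ a∉f inj {suc i} {zero}  eq = ⊥-elim (a∉f i eq)
injective-◂ a∉f inj {suc i} {suc j} eq = cong suc (inj eq)

module _ {m k : ℕ} (h : Fin m → Fin (suc k)) (0∉h : ∀ i → zero ≢ h i) where

  lower : Fin m → Fin k
  lower i = punchOut (0∉h i)

  suc-lower : ∀ i → suc (lower i) ≡ h i
  suc-lower i = punchIn-punchOut (0∉h i)

  lower-injective : Injective _≡_ _≡_ h → Injective _≡_ _≡_ lower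
  lower-injective inj {i} {j} eq = inj (punchOut-injective (0∉h i) (0∉h j) eq)

module _ {A : Set} (P : A → Bool) where

  countᵇ-∷-T : ∀ {k x} (xs : Vec A k) → T (P x) → countᵇ P (x ∷ xs) ≡ suc (countᵇ P xs)
  countᵇ-∷-T {x = x} xs Px with P x
  ... | true = refl

  countᵇ-∷-≥ : ∀ {k} x (xs : Vec A k) → countᵇ P xs ≤ countᵇ P (x ∷ xs)
  countᵇ-∷-≥ x xs with P x
  ... | true  = n≤1+n _
  ... | false = ≤-refl

  injective⇒≤-countᵇ : ∀ {k m} (g : Fin k → A) (h : Fin m → Fin k) →
                       Injective _≡_ _≡_ h → (∀ i → T (P (g (h i)))) → m ≤ countᵇ P (tabulate g)
  injective⇒≤-countᵇ {zero} g h inj _ = injective⇒≤ inj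
  injective⇒≤-countᵇ {suc k} g h inj Ph with any? (λ i → h i ≟ zero)
  injective⇒≤-countᵇ {suc k} {zero}  g h inj Ph | yes (() , _)
  injective⇒≤-countᵇ {suc k} {suc m} g h inj Ph | yes (i₀ , hi₀≡0) =
    subst (suc m ≤_) (sym (countᵇ-∷-T (tabulate (g ∘ suc)) (subst (T ∘ P ∘ g) hi₀≡0 (Ph i₀))))
      (s≤s (injective⇒≤-countᵇ (g ∘ suc) (lower h′ 0∉h′) (lower-injective h′ 0∉h′ inj′)
              (λ i → subst (T ∘ P ∘ g) (sym (suc-lower h′ 0∉h′ i)) (Ph (punchIn i₀ i)))))
    where
    h′ : Fin m → Fin (suc k)
    h′ = h ∘ punchIn i₀
    0∉h′ : ∀ i → zero ≢ h′ i
    0∉h′ i 0≡h′i = punchInᵢ≢i i₀ i (inj (trans (sym 0≡h′i) (sym hi₀≡0)))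
    inj′ : Injective _≡_ _≡_ h′
    inj′ eq = punchIn-injective i₀ _ _ (inj eq)
  ... | no 0∉image =
    ≤-trans (injective⇒≤-countᵇ (g ∘ suc) (lower h 0∉h) (lower-injective h 0∉h inj)
               (λ i → subst (T ∘ P ∘ g) (sym (suc-lower h 0∉h i)) (Ph i)))
            (countᵇ-∷-≥ (g zero) (tabulate (g ∘ suc)))
    where
    0∉h : ∀ i → zero ≢ h i
    0∉h i 0≡hi = 0∉image (i , sym 0≡hi)

third : ∀ {m} (x y : Fin (3 + m)) → ∃ λ z → z ≢ x × z ≢ y
third zero          zero          = suc zero , (λ ()) , (λ ())
third zero          (suc zero)    = suc (suc zero) , (λ ()) , (λ ())
third zero          (suc (suc _)) = suc zero , (λ ()) , (λ ())
third (suc zero)    zero          = suc (suc zero) , (λ ()) , (λ ())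
third (suc zero)    (suc _)       = zero , (λ ()) , (λ ())
third (suc (suc _)) zero          = suc zero , (λ ()) , (λ ())
third (suc (suc _)) (suc _)       = zero , (λ ()) , (λ ())

module _ {n : ℕ} (G : FinGraph n) where

  injective⇒≤-degree : ∀ {m v} (h : Fin m → Fin n) →
                       Injective _≡_ _≡_ h → (∀ i → Adj G v (h i)) → m ≤ degree G v
  injective⇒≤-degree = injective⇒≤-countᵇ (adj G _) id

  ∉⇒¬edge : ∀ (H : Subgraph G) {u v} → ¬ inV H v → ¬ inE H u v
  ∉⇒¬edge H v∉H uv = v∉H (proj₂ (E-end H uv))

  atMostOneNeighbourOutside : ∀ {t w u₁ u₂} (H : Subgraph G) → degree G w ≤ t + 1 →
    (nb : Fin t → Fin n) → Injective _≡_ _≡_ nb → (∀ i → inE H w (nb i)) →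
    u₁ ≢ u₂ → Adj G w u₁ → Adj G w u₂ → ¬ inE H w u₁ → ¬ inE H w u₂ → ⊥
  atMostOneNeighbourOutside {t} {w} {u₁} {u₂} H deg nb nb-inj nb∈ u₁≢u₂ wu₁ wu₂ u₁∉ u₂∉ =
    1+n≰n (subst (2 + t ≤_) (+-comm t 1) (≤-trans (injective⇒≤-degree h h-inj h-adj) deg))
    where
    h : Fin (2 + t) → Fin n
    h = u₁ ◂ u₂ ◂ nb
    nb≢ : ∀ {u} → ¬ inE H w u → ∀ i → nb i ≢ u
    nb≢ u∉ i refl = u∉ (nb∈ i)
    h-inj : Injective _≡_ _≡_ h
    h-inj = injective-◂ (λ { zero → u₁≢u₂ ∘ sym ; (suc i) → nb≢ u₁∉ i })
                        (injective-◂ (nb≢ u₂∉) nb-inj)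
    h-adj : ∀ i → Adj G w (h i)
    h-adj zero          = wu₁
    h-adj (suc zero)    = wu₂
    h-adj (suc (suc i)) = E⊆G H (nb∈ i)

module KCopy {n p q} {G : FinGraph n} {H : Subgraph G} (iso : IsomorphicTo H (Kpq p q)) where

  embed : Fin p × Fin q → Fin n
  embed = proj₁ iso

  embed-injective : Injective _≡_ _≡_ embed
  embed-injective = proj₁ (proj₂ iso)

  private
    vertices : ∀ v → inV H v ⇔ (∃ λ x → embed x ≡ v)
    vertices = proj₁ (proj₂ (proj₂ iso))

    edges : ∀ x y → proj₁ x ≢ proj₁ y ⇔ inE H (embed x) (embed y)
    edges = proj₂ (proj₂ (proj₂ iso))

  embed∈ : ∀ x → inV H (embed x)
  embed∈ x = Equivalence.from (vertices _) (x , refl)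

  ∈⇒embed : ∀ {v} → inV H v → ∃ λ x → embed x ≡ v
  ∈⇒embed = Equivalence.to (vertices _)

  ∈? : ∀ v → Dec (inV H v)
  ∈? v = map′ (Equivalence.from (vertices v)) ∈⇒embed (any?-× λ x → embed x ≟ v)

  edge : ∀ {x y u v} → embed x ≡ u → embed y ≡ v → proj₁ x ≢ proj₁ y → inE H u v
  edge refl refl = Equivalence.to (edges _ _)

  edge⇒apart : ∀ {x y u v} → embed x ≡ u → embed y ≡ v → inE H u v → proj₁ x ≢ proj₁ y
  edge⇒apart refl refl = Equivalence.from (edges _ _)

  sameClass⇒¬edge : ∀ {x y u v} → embed x ≡ u → embed y ≡ v → proj₁ x ≡ proj₁ y → ¬ inE H u v
  sameClass⇒¬edge x≡u y≡v x≈y uv = edge⇒apart x≡u y≡v uv x≈y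

module _ {n p′ q} {G : FinGraph n} {H : Subgraph G} (iso : IsomorphicTo H (Kpq (suc p′) q)) where

  open KCopy {H = H} iso

  copyNeighbours : ∀ {w} → inV H w →
    Σ (Fin (p′ * q) → Fin n) λ nb → Injective _≡_ _≡_ nb × (∀ i → inE H w (nb i))
  copyNeighbours w∈H with ∈⇒embed w∈H
  ... | a , refl =
    embed ∘ other , other-injective ∘ embed-injective , λ i → edge refl refl (punchInᵢ≢i (proj₁ a) _ ∘ sym)
    where
    other : Fin (p′ * q) → Fin (suc p′) × Fin q
    other i = punchIn (proj₁ a) (proj₁ (remQuot {p′} q i)) , proj₂ (remQuot {p′} q i)
    other-injective : Injective _≡_ _≡_ other
    other-injective eq = remQuot-injective q
      (cong₂ _,_ (punchIn-injective (proj₁ a) _ _ (cong proj₁ eq)) (cong proj₂ eq))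

module CommonVertex {n p′ q} {G : FinGraph n} {Ha Hb : Subgraph G}
  (isoA : IsomorphicTo Ha (Kpq (suc p′) q)) (isoB : IsomorphicTo Hb (Kpq (suc p′) q)) where

  private module A = KCopy {H = Ha} isoA

  defect : ∀ {a} x₁ x₂ → degree G (A.embed a) ≤ p′ * q + 1 → inV Hb (A.embed a) →
    x₁ ≢ x₂ → proj₁ x₁ ≢ proj₁ a → proj₁ x₂ ≢ proj₁ a →
    ¬ inE Hb (A.embed a) (A.embed x₁) → ¬ inE Hb (A.embed a) (A.embed x₂) → ⊥
  defect {a} x₁ x₂ deg a∈Hb x₁≢x₂ x₁≉a x₂≉a with copyNeighbours {H = Hb} isoB a∈Hb
  ... | nb , nb-injective , nb∈ =
    atMostOneNeighbourOutside G Hb deg nb nb-injective nb∈ (x₁≢x₂ ∘ A.embed-injective)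
      (adjacent x₁≉a) (adjacent x₂≉a)
    where
    adjacent : ∀ {x} → proj₁ x ≢ proj₁ a → Adj G (A.embed a) (A.embed x)
    adjacent x≉a = E⊆G Ha (A.edge refl refl (x≉a ∘ sym))

module _ {p q} (a : Fin (suc p) × Fin (suc q)) where

  avoiding : Vtx (Iₙ q ×ᴳ Kpq p (suc q)) → Fin (suc p) × Fin (suc q)
  avoiding (inj₁ j)       = proj₁ a , punchIn (proj₂ a) j
  avoiding (inj₂ (i , j)) = punchIn (proj₁ a) i , j

  avoiding-≢ : ∀ x → avoiding x ≢ a
  avoiding-≢ (inj₁ j)       eq = punchInᵢ≢i (proj₂ a) j (cong proj₂ eq)
  avoiding-≢ (inj₂ (i , j)) eq = punchInᵢ≢i (proj₁ a) i (cong proj₁ eq)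

  avoiding-injective : Injective _≡_ _≡_ avoiding
  avoiding-injective {inj₁ j} {inj₁ j′} eq = cong inj₁ (punchIn-injective (proj₂ a) j j′ (cong proj₂ eq))
  avoiding-injective {inj₁ _} {inj₂ (i , _)} eq = ⊥-elim (punchInᵢ≢i (proj₁ a) i (sym (cong proj₁ eq)))
  avoiding-injective {inj₂ (i , _)} {inj₁ _} eq = ⊥-elim (punchInᵢ≢i (proj₁ a) i (cong proj₁ eq))
  avoiding-injective {inj₂ (i , j)} {inj₂ (i′ , j′)} eq =
    cong inj₂ (cong₂ _,_ (punchIn-injective (proj₁ a) i i′ (cong proj₁ eq)) (cong proj₂ eq))

  avoiding-apart : ∀ x y → E (Iₙ q ×ᴳ Kpq p (suc q)) x y → proj₁ (avoiding x) ≢ proj₁ (avoiding y)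
  avoiding-apart (inj₁ _)       (inj₁ _)         ()
  avoiding-apart (inj₁ _)       (inj₂ (i , _))   _    eq = punchInᵢ≢i (proj₁ a) i (sym eq)
  avoiding-apart (inj₂ (i , _)) (inj₁ _)         _    eq = punchInᵢ≢i (proj₁ a) i eq
  avoiding-apart (inj₂ (i , _)) (inj₂ (i′ , _)) i≢i′ eq = i≢i′ (punchIn-injective (proj₁ a) i i′ eq)

module TwoCopies {n p′ q′} {G : FinGraph n}
  (deg≤ : ∀ v → degree G v ≤ (2 + p′) * (3 + q′) + 1)
  {H₁ H₂ : Subgraph G}
  (iso₁ : IsomorphicTo H₁ (Kpq (3 + p′) (3 + q′)))
  (iso₂ : IsomorphicTo H₂ (Kpq (3 + p′) (3 + q′)))
  where

  Pos : Set
  Pos = Fin (3 + p′) × Fin (3 + q′)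

  private
    module C₁ = KCopy {H = H₁} iso₁
    module C₂ = KCopy {H = H₂} iso₂
    open CommonVertex {Ha = H₂} {Hb = H₁} iso₂ iso₁ using () renaming (defect to defect₁)
    open CommonVertex {Ha = H₁} {Hb = H₂} iso₁ iso₂ using () renaming (defect to defect₂)

    f₁ f₂ : Pos → Fin n
    f₁ = C₁.embed
    f₂ = C₂.embed

  everyClassMeetsH₂ : (∃ λ v → inV H₁ v × inV H₂ v) → ∀ k → ¬ (∀ j → ¬ inV H₂ (f₁ (k , j)))
  everyClassMeetsH₂ (_ , w∈H₁ , w∈H₂) k none with C₁.∈⇒embed w∈H₁
  ... | a , refl with proj₁ a ≟ k
  ...   | yes refl = none (proj₂ a) w∈H₂
  ...   | no a≉k = defect₂ (k , zero) (k , suc zero) (deg≤ _) w∈H₂ (0≢1+n ∘ cong proj₂)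
                     (a≉k ∘ sym) (a≉k ∘ sym) (∉⇒¬edge G H₂ (none zero)) (∉⇒¬edge G H₂ (none (suc zero)))

  atMostOneOutsideH₂ : (∃ λ v → inV H₁ v × inV H₂ v) →
    ∀ {x y} → x ≢ y → ¬ inV H₂ (f₁ x) → ¬ inV H₂ (f₁ y) → ⊥
  atMostOneOutsideH₂ common {x} {y} x≢y x∉H₂ y∉H₂ with third (proj₁ x) (proj₁ y)
  ... | k , k≢x , k≢y = everyClassMeetsH₂ common k λ j kj∈H₂ →
    defect₂ x y (deg≤ _) kj∈H₂ x≢y (k≢x ∘ sym) (k≢y ∘ sym) (∉⇒¬edge G H₂ x∉H₂) (∉⇒¬edge G H₂ y∉H₂)

  distinct₂⇒distinct₁ : ∀ {x x′ b b′} → f₁ x ≡ f₂ b → f₁ x′ ≡ f₂ b′ → b ≢ b′ → x ≢ x′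
  distinct₂⇒distinct₁ x≡b x′≡b′ b≢b′ refl = b≢b′ (C₂.embed-injective (trans (sym x≡b) x′≡b′))

  module SameClassInH₂ {x y bx by : Pos} (x≡ : f₁ x ≡ f₂ bx) (y≡ : f₁ y ≡ f₂ by)
    (x≉y : proj₁ x ≢ proj₁ y) (bx≈by : proj₁ bx ≡ proj₁ by) where

    x∈H₂ : inV H₂ (f₁ x)
    x∈H₂ = subst (inV H₂) (sym x≡) (C₂.embed∈ bx)

    y∈H₂ : inV H₂ (f₁ y)
    y∈H₂ = subst (inV H₂) (sym y≡) (C₂.embed∈ by)

    otherMember∉H₁ : ∀ {m} → proj₁ m ≡ proj₁ bx → m ≢ bx → m ≢ by → ¬ inV H₁ (f₂ m)
    otherMember∉H₁ {m} m≈bx m≢bx m≢by m∈H₁ with C₁.∈⇒embed m∈H₁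
    ... | c , c≡ with proj₁ c ≟ proj₁ x
    ...   | no c≉x = defect₂ y c (deg≤ _) x∈H₂ (distinct₂⇒distinct₁ y≡ c≡ (m≢by ∘ sym))
                       (x≉y ∘ sym) c≉x
                       (C₂.sameClass⇒¬edge (sym x≡) (sym y≡) bx≈by)
                       (C₂.sameClass⇒¬edge (sym x≡) (sym c≡) (sym m≈bx))
    ...   | yes c≈x = defect₂ x c (deg≤ _) y∈H₂ (distinct₂⇒distinct₁ x≡ c≡ (m≢bx ∘ sym))
                        x≉y (x≉y ∘ trans (sym c≈x))
                        (C₂.sameClass⇒¬edge (sym y≡) (sym x≡) (sym bx≈by))
                        (C₂.sameClass⇒¬edge (sym y≡) (sym c≡) (trans (sym bx≈by) (sym m≈bx)))

    -- Were y H₂-adjacent to z, the common vertex z would have the two H₂-neighbours bx and a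
    -- third member of the H₂-class of bx, neither of them an H₁-neighbour of z.
    ¬edge-y-classOf-x : ∀ {z} → proj₁ z ≡ proj₁ x → ¬ inE H₂ (f₁ y) (f₁ z)
    ¬edge-y-classOf-x {z} z≈x yz with C₂.∈⇒embed (proj₂ (E-end H₂ yz)) | third (proj₂ bx) (proj₂ by)
    ... | bz , bz≡ | j , j≢bx , j≢by =
      defect₁ bx m (deg≤ _) (subst (inV H₁) (sym bz≡) (C₁.embed∈ z))
        (j≢bx ∘ sym ∘ cong proj₂) bx≉bz bx≉bz
        (C₁.sameClass⇒¬edge (sym bz≡) x≡ z≈x)
        (∉⇒¬edge G H₁ (otherMember∉H₁ refl (j≢bx ∘ cong proj₂) (j≢by ∘ cong proj₂)))
      where
      m : Pos
      m = proj₁ bx , j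
      bx≉bz : proj₁ bx ≢ proj₁ bz
      bx≉bz = C₂.edge⇒apart (sym y≡) bz≡ yz ∘ trans (sym bx≈by)

    absurd : ⊥
    absurd = defect₂ x z (deg≤ _) y∈H₂ (punchInᵢ≢i (proj₂ x) zero ∘ sym ∘ cong proj₂) x≉y x≉y
               (C₂.sameClass⇒¬edge (sym y≡) (sym x≡) (sym bx≈by)) (¬edge-y-classOf-x refl)
      where
      z : Pos
      z = proj₁ x , punchIn (proj₂ x) zero

  edge₁⇒edge₂ : ∀ {x y} → inV H₂ (f₁ x) → inV H₂ (f₁ y) → proj₁ x ≢ proj₁ y → inE H₂ (f₁ x) (f₁ y)
  edge₁⇒edge₂ x∈H₂ y∈H₂ x≉y with C₂.∈⇒embed x∈H₂ | C₂.∈⇒embed y∈H₂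
  ... | bx , bx≡ | by , by≡ = C₂.edge bx≡ by≡ (SameClassInH₂.absurd (sym bx≡) (sym by≡) x≉y)

  allButOneInH₂ : (∃ λ v → inV H₁ v × inV H₂ v) → ∃ λ a → ∀ x → x ≢ a → inV H₂ (f₁ x)
  allButOneInH₂ common with any?-× (λ x → ¬? (C₂.∈? (f₁ x)))
  ... | yes (a , a∉H₂) = a , λ x x≢a →
          decidable-stable (C₂.∈? (f₁ x)) λ x∉H₂ → atMostOneOutsideH₂ common x≢a x∉H₂ a∉H₂
  ... | no noneOutside = (zero , zero) , λ x _ →
          decidable-stable (C₂.∈? (f₁ x)) λ x∉H₂ → noneOutside (x , x∉H₂)

  intersectionContainsJoin : (a : Pos) → (∀ x → x ≢ a → inV H₂ (f₁ x)) →
    ContainsCopyOf (H₁ ∩ˢ H₂) (Iₙ (2 + q′) ×ᴳ Kpq (2 + p′) (3 + q′))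
  intersectionContainsJoin a rest∈H₂ =
    f₁ ∘ avoiding a ,
    avoiding-injective a ∘ C₁.embed-injective ,
    (λ x → C₁.embed∈ (avoiding a x) , in₂ x) ,
    λ x y xy → C₁.edge refl refl (avoiding-apart a x y xy) ,
               edge₁⇒edge₂ (in₂ x) (in₂ y) (avoiding-apart a x y xy)
    where
    in₂ : ∀ x → inV H₂ (f₁ (avoiding a x))
    in₂ x = rest∈H₂ (avoiding a x) (avoiding-≢ a x)

lemma6 : (p q : ℕ) → 3 ≤ p → 3 ≤ q →
         {n : ℕ} (G : FinGraph n) →
         (∀ v → degree G v ≤ (p ∸ 1) * q + 1) →
         (H₁ H₂ : Subgraph G) →
         IsomorphicTo H₁ (Kpq p q) → IsomorphicTo H₂ (Kpq p q) →
         ¬ SameSubgraph H₁ H₂ →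
         (∃ λ v → inV H₁ v × inV H₂ v) →
         ContainsCopyOf (H₁ ∩ˢ H₂) (Iₙ (q ∸ 1) ×ᴳ Kpq (p ∸ 1) q)
lemma6 (suc (suc (suc _))) (suc (suc (suc _))) (s≤s (s≤s (s≤s _))) (s≤s (s≤s (s≤s _)))
       G deg≤ H₁ H₂ iso₁ iso₂ _ common =
  uncurry intersectionContainsJoin (allButOneInH₂ common)
  where open TwoCopies deg≤ {H₁} {H₂} iso₁ iso₂
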